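{- Every outerplanar graph $G$ has $\operatorname{tlir}(G) \leq 3$.
   Context: Graphs are finite and simple. A total coloring of $G$ assigns a color to every vertex and every edge. For a color $c$ and a vertex $v$, the total $c$-degree of $v$ is the number of edges of color $c$ incident to $v$, plus $1$ if $v$ has color $c$. A total coloring is a locally irregular total coloring (TLIR coloring) if for every edge $uv$, with $c$ the color of $uv$, the total $c$-degrees of $u$ and $v$ differ. $\operatorname{tlir}(G)$ is the minimum number of colors in a TLIR coloring of $G$. -}

module Defs where

open import Data.Nat using (ℕ; zero; suc; _+_)
open import Data.Fin using (Fin; toℕ; _<_)
open import Data.Fin.Properties using (_≟_)
open import Data.Bool using (Bool; true; false; _∧_)
open import Data.List using (List; length; filterᵇ; allFin)
open import Data.Product using (Σ; _×_)
open import Relation.Nullary using (¬_)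
open import Relation.Nullary.Decidable using (⌊_⌋)
open import Relation.Binary.PropositionalEquality using (_≡_; _≢_)
open import Function.Definitions using (Injective)

record Graph (n : ℕ) : Set where
  field
    adj   : Fin n → Fin n → Bool
    sym   : ∀ u v → adj u v ≡ adj v u
    irrefl : ∀ v → adj v v ≡ false
open Graph public

-- Outerplanar: the vertices can be placed at distinct positions on a
-- circle (pos injective) so that no two edges, drawn as chords, cross.
-- Chords ab and cd cross iff pos a < pos c < pos b < pos d (for some
-- orientation of the two edges; adjacency is symmetric).
Outerplanar : ∀ {n} → Graph n → Set
Outerplanar {n} G =
  Σ (Fin n → Fin n) λ pos →
    Injective _≡_ _≡_ pos ×
    (∀ a b c d → adj G a b ≡ true → adj G c d ≡ true →
       ¬ (pos a < pos c × pos c < pos b × pos b < pos d))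

-- A total coloring with k colors: a color for each vertex and for each
-- edge (the edge coloring is a function on ordered pairs that must be
-- symmetric on edges; values on non-edges are irrelevant).
record TotalColoring {n} (G : Graph n) (k : ℕ) : Set where
  field
    vcol : Fin n → Fin k
    ecol : Fin n → Fin n → Fin k
    ecol-sym : ∀ u v → adj G u v ≡ true → ecol u v ≡ ecol v u
open TotalColoring public

indicator : Bool → ℕ
indicator true = 1
indicator false = 0

totalDeg : ∀ {n k} {G : Graph n} → TotalColoring G k → Fin k → Fin n → ℕ
totalDeg {n} {k} {G} φ c v =
  length (filterᵇ (λ w → adj G v w ∧ ⌊ ecol φ v w ≟ c ⌋) (allFin n))
  + indicator ⌊ vcol φ v ≟ c ⌋

IsTLIR : ∀ {n k} {G : Graph n} → TotalColoring G k → Set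
IsTLIR {G = G} φ = ∀ u v → adj G u v ≡ true →
  totalDeg φ (ecol φ u v) u ≢ totalDeg φ (ecol φ u v) v

TlirAtMost : ∀ {n} → Graph n → ℕ → Set
TlirAtMost G k = Σ (TotalColoring G k) IsTLIR

{-# OPTIONS --safe #-}
module Submission where

-- Outerplanar graphs are 2-degenerate, so their vertices can be ranked such that every vertex
-- has at most two earlier neighbours.  We colour greedily along the ranking.  When a vertex v
-- is settled, the edges to its earlier neighbours are already coloured and the total degrees
-- of those neighbours are final; v chooses its own colour a and the colour b of one edge to a
-- later neighbour so that its edges to the earlier neighbours become irregular, and gives
-- every other edge to a later neighbour a colour fixed in advance.
-- The danger is a later vertex w without later neighbours whose earlier neighbours are v and
-- some o before v: when w is reached it can only choose its own colour.  Therefore the colour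
-- that v gives to vw is chosen so that w stays colourable: either it is the free colour b, or
-- it is a colour that keeps w colourable whatever degree v ends up with.  A case analysis over
-- three colours shows that a suitable pair (a , b) always exists.

open import Algebra.Properties.CommutativeSemigroup as CSemigroup using ()
open import Data.Bool using (Bool; true; false; _∧_; not; if_then_else_)
open import Data.Bool.Properties using (∧-zeroʳ; ∧-identityʳ; ¬-not)
open import Data.Empty using (⊥-elim)
open import Data.Fin using (Fin; zero; suc; toℕ)
open import Data.Fin.Properties using (_≟_; any?; all?; toℕ-injective)
open import Data.List using (length; filterᵇ; allFin; tabulate)
open import Data.Maybe using (Maybe; just; nothing; _>>=_)
open import Data.Maybe.Properties using (just-injective)
open import Data.Nat using (ℕ; zero; suc; _+_; _∸_; _≤_; _<_; z≤n; s≤s; s≤s⁻¹; _≤?_; _<?_)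
open import Data.Nat.Induction using (<-rec; <-wellFounded)
open import Data.Nat.Properties
  using ( +-comm; +-identityʳ; +-mono-≤; +-monoˡ-≤; +-commutativeSemigroup; suc-injective
        ; ≤-refl; ≤-trans; <⇒≤; <⇒≱; ≮⇒≥; ≰⇒>; ≤∧≢⇒<; ≤-<-trans; <-trans; <-irrefl; <-asym; <-cmp
        ; m≤n⇒m≤1+n; n<1+n; 1+n≢n; >⇒≢; ∸-monoˡ-≤; ∸-monoʳ-≤; ∸-monoˡ-<; ∸-monoʳ-< )
  renaming (_≟_ to _≟ℕ_)
open import Data.Product using (∃; ∃₂; _×_; _,_; proj₁; proj₂)
open import Data.Sum using (_⊎_; inj₁; inj₂; [_,_]; swap)
open import Data.Unit using (⊤; tt)
open import Function using (_∘_; id; case_of_)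
open import Induction.WellFounded using (module All)
open import Relation.Binary using (tri<; tri≈; tri>)
import Relation.Binary.Construct.On as On
open import Relation.Binary.PropositionalEquality
  using (_≡_; _≢_; refl; sym; trans; cong; cong₂; subst; subst₂; ≢-sym; module ≡-Reasoning)
open import Relation.Nullary using (Dec; yes; no; ¬_; ¬?; _×-dec_; _⊎-dec_; _→-dec_)
open import Relation.Nullary.Decidable using (⌊_⌋; ⌊⌋-map′)
import Data.Bool.Properties as Bool
import Data.Fin.Properties as Fin
import Data.Maybe.Properties as Maybe

open import Defs hiding (sym)

open CSemigroup +-commutativeSemigroup using (x∙yz≈y∙xz; xy∙z≈xz∙y; interchange)

private
  variable
    n : ℕ

module _ {A : Set} where

  ⌊⌋-true⁻ : {d : Dec A} → ⌊ d ⌋ ≡ true → A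
  ⌊⌋-true⁻ {yes a} _ = a

  ⌊⌋-true : (d : Dec A) → A → ⌊ d ⌋ ≡ true
  ⌊⌋-true (yes _) _ = refl
  ⌊⌋-true (no ¬a) a = ⊥-elim (¬a a)

  ⌊⌋-false : (d : Dec A) → ¬ A → ⌊ d ⌋ ≡ false
  ⌊⌋-false (yes a) ¬a = ⊥-elim (¬a a)
  ⌊⌋-false (no _)  _  = refl

∧-true⁻ : ∀ a {b} → a ∧ b ≡ true → a ≡ true × b ≡ true
∧-true⁻ true {true} _ = refl , refl

∧-true : ∀ {a b} → a ≡ true → b ≡ true → a ∧ b ≡ true
∧-true refl refl = refl

∧-cong : ∀ {a x y} → (a ≡ true → x ≡ y) → a ∧ x ≡ a ∧ y
∧-cong {true}  x≡y = x≡y refl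
∧-cong {false} _   = refl

≡-≢-trans : ∀ {A : Set} {x y z : A} → x ≡ y → y ≢ z → x ≢ z
≡-≢-trans refl y≢z = y≢z

infix 4 _==_
_==_ : Fin n → Fin n → Bool
x == y = ⌊ x ≟ y ⌋

==-refl : (x : Fin n) → (x == x) ≡ true
==-refl x = ⌊⌋-true (x ≟ x) refl

==-≢ : {x y : Fin n} → x ≢ y → (x == y) ≡ false
==-≢ {x = x} {y} = ⌊⌋-false (x ≟ y)

adj-sym : (G : Graph n) {u v : Fin n} → adj G u v ≡ true → adj G v u ≡ true
adj-sym G {u} {v} uv = trans (Graph.sym G v u) uv

adj-≢ : (G : Graph n) {u v : Fin n} → adj G u v ≡ true → u ≢ v
adj-≢ G {u} uv refl with trans (sym uv) (irrefl G u)
... | ()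

count : (Fin n → Bool) → ℕ
count {zero}  p = 0
count {suc n} p = indicator (p zero) + count (p ∘ suc)

infixl 5 _∖_
_∖_ : (Fin n → Bool) → Fin n → Fin n → Bool
(p ∖ x) y = p y ∧ not (y == x)

length-filterᵇ-allFin : (p : Fin n → Bool) → length (filterᵇ p (allFin n)) ≡ count p
length-filterᵇ-allFin p = go p id
  where
  go : ∀ {A : Set} {m} (p : A → Bool) (f : Fin m → A) → length (filterᵇ p (tabulate f)) ≡ count (p ∘ f)
  go {m = zero}  p f = refl
  go {m = suc m} p f with p (f zero)
  ... | true  = cong suc (go p (f ∘ suc))
  ... | false = go p (f ∘ suc)

count-cong : {p q : Fin n → Bool} → (∀ x → p x ≡ q x) → count p ≡ count q
count-cong {zero}  eq = refl
count-cong {suc n} eq = cong₂ _+_ (cong indicator (eq zero)) (count-cong (eq ∘ suc))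

count-mono : (p q : Fin n → Bool) → (∀ x → p x ≡ true → q x ≡ true) → count p ≤ count q
count-mono {zero}  p q p⊆q = z≤n
count-mono {suc n} p q p⊆q =
  +-mono-≤ (indicator-mono (p zero) (p⊆q zero)) (count-mono (p ∘ suc) (q ∘ suc) (p⊆q ∘ suc))
  where
  indicator-mono : ∀ a {b} → (a ≡ true → b ≡ true) → indicator a ≤ indicator b
  indicator-mono false _ = z≤n
  indicator-mono true  h rewrite h refl = ≤-refl

count-split : (p : Fin n → Bool) (x : Fin n) → count p ≡ indicator (p x) + count (p ∖ x)
count-split {suc n} p zero = cong (indicator (p zero) +_) (sym (cong₂ _+_
  (cong indicator (∧-zeroʳ (p zero))) (count-cong λ y → ∧-identityʳ (p (suc y)))))
count-split {suc n} p (suc x) = begin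
  indicator (p zero) + count (p ∘ suc)
    ≡⟨ cong (indicator (p zero) +_) (count-split (p ∘ suc) x) ⟩
  indicator (p zero) + (indicator (p (suc x)) + count (p ∘ suc ∖ x))
    ≡⟨ x∙yz≈y∙xz (indicator (p zero)) (indicator (p (suc x))) _ ⟩
  indicator (p (suc x)) + (indicator (p zero) + count (p ∘ suc ∖ x))
    ≡⟨ cong (indicator (p (suc x)) +_) (sym rest≡) ⟩
  indicator (p (suc x)) + count (p ∖ suc x) ∎
  where
  open ≡-Reasoning
  rest≡ : count (p ∖ suc x) ≡ indicator (p zero) + count (p ∘ suc ∖ x)
  rest≡ = cong₂ _+_ (cong indicator (∧-identityʳ (p zero)))
    (count-cong λ y → cong (λ b → p (suc y) ∧ not b) (⌊⌋-map′ (cong suc) Fin.suc-injective (y ≟ x)))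

∖-true⁻ : (p : Fin n → Bool) {x y : Fin n} → (p ∖ x) y ≡ true → p y ≡ true × y ≢ x
∖-true⁻ p {x} {y} h with p y | y ≟ x
... | true | no y≢x = refl , y≢x

∖-true : (p : Fin n → Bool) {x y : Fin n} → p y ≡ true → y ≢ x → (p ∖ x) y ≡ true
∖-true p py y≢x rewrite py | ==-≢ y≢x = refl

∖-cong : (p q : Fin n → Bool) (x : Fin n) → (∀ y → y ≢ x → p y ≡ q y) → ∀ y → (p ∖ x) y ≡ (q ∖ x) y
∖-cong p q x p≗q y with y ≟ x
... | yes _   = trans (∧-zeroʳ (p y)) (sym (∧-zeroʳ (q y)))
... | no  y≢x = cong (_∧ true) (p≗q y y≢x)

count-remove : (p : Fin n → Bool) {x : Fin n} → p x ≡ true → count p ≡ suc (count (p ∖ x))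
count-remove p {x} px rewrite count-split p x | px = refl

count-pos : (p : Fin n → Bool) {x : Fin n} → p x ≡ true → 0 < count p
count-pos p px rewrite count-remove p px = s≤s z≤n

count-pos₂ : (p : Fin n → Bool) {x y : Fin n} → x ≢ y → p x ≡ true → p y ≡ true → 1 < count p
count-pos₂ p x≢y px py rewrite count-remove p px = s≤s (count-pos (p ∖ _) (∖-true p py (x≢y ∘ sym)))

count-none : (p : Fin n → Bool) → (∀ x → p x ≡ false) → count p ≡ 0
count-none {n} p none = trans (count-cong none) (count-false n)
  where
  count-false : ∀ m → count {m} (λ _ → false) ≡ 0
  count-false zero    = refl
  count-false (suc m) = count-false m

count-all : ∀ n → count {n} (λ _ → true) ≡ n
count-all zero    = refl
count-all (suc n) = cong suc (count-all n)

count-witness : (p : Fin n → Bool) → 0 < count p → ∃ λ x → p x ≡ true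
count-witness {suc n} p pos with p zero in p0
... | true  = zero , p0
... | false = let x , px = count-witness (p ∘ suc) pos in suc x , px

count-witness₂ : (p : Fin n → Bool) → 1 < count p → ∃₂ λ x y → x ≢ y × p x ≡ true × p y ≡ true
count-witness₂ p big =
  let x , px = count-witness p (≤-trans (s≤s z≤n) big)
      y , p∖xy = count-witness (p ∖ x) (s≤s⁻¹ (subst (1 <_) (count-remove p px) big))
      py , y≢x = ∖-true⁻ p p∖xy
  in x , y , y≢x ∘ sym , px , py

AtMostTwo : (Fin n → Bool) → Set
AtMostTwo p =
  (∀ z → p z ≡ false) ⊎ ∃₂ λ x y → p x ≡ true × p y ≡ true × (∀ z → p z ≡ true → z ≡ x ⊎ z ≡ y)

count≤2⇒atMostTwo : (p : Fin n → Bool) → count p ≤ 2 → AtMostTwo p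
count≤2⇒atMostTwo p small with any? (λ x → p x Bool.≟ true)
... | no ∄x = inj₁ λ z → ¬-not (∄x ∘ (z ,_))
... | yes (x , px) with any? (λ y → (p ∖ x) y Bool.≟ true)
...   | no ∄y = inj₂ (x , x , px , px , λ z pz → inj₁ (only-x z pz))
  where
  only-x : ∀ z → p z ≡ true → z ≡ x
  only-x z pz with z ≟ x
  ... | yes z≡x = z≡x
  ... | no  z≢x = ⊥-elim (∄y (z , ∖-true p pz z≢x))
...   | yes (y , p∖xy) = inj₂ (x , y , px , proj₁ (∖-true⁻ p p∖xy) , cover)
  where
  rest≤0 : count (p ∖ x ∖ y) ≤ 0
  rest≤0 = s≤s⁻¹ (s≤s⁻¹ (subst (_≤ 2) size small))
    where size = trans (count-remove p px) (cong suc (count-remove (p ∖ x) p∖xy))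
  cover : ∀ z → p z ≡ true → z ≡ x ⊎ z ≡ y
  cover z pz with z ≟ x | z ≟ y
  ... | yes z≡x | _       = inj₁ z≡x
  ... | no  _   | yes z≡y = inj₂ z≡y
  ... | no  z≢x | no  z≢y =
    ⊥-elim (<⇒≱ (count-pos (p ∖ x ∖ y) (∖-true (p ∖ x) (∖-true p pz z≢x) z≢y)) rest≤0)

count-⊆pair : (p : Fin n → Bool) {x y : Fin n} → x ≢ y → (∀ z → p z ≡ true → z ≡ x ⊎ z ≡ y) →
  count p ≡ indicator (p x) + indicator (p y)
count-⊆pair p {x} {y} x≢y cover = begin
  count p
    ≡⟨ count-split p x ⟩
  indicator (p x) + count (p ∖ x)
    ≡⟨ cong (indicator (p x) +_) (count-split (p ∖ x) y) ⟩
  indicator (p x) + (indicator ((p ∖ x) y) + count (p ∖ x ∖ y))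
    ≡⟨ cong (λ b → indicator (p x) + (indicator b + count (p ∖ x ∖ y))) p∖xy≡ ⟩
  indicator (p x) + (indicator (p y) + count (p ∖ x ∖ y))
    ≡⟨ cong (λ k → indicator (p x) + (indicator (p y) + k)) (count-none _ rest) ⟩
  indicator (p x) + (indicator (p y) + 0)
    ≡⟨ cong (indicator (p x) +_) (+-identityʳ _) ⟩
  indicator (p x) + indicator (p y) ∎
  where
  open ≡-Reasoning
  p∖xy≡ : (p ∖ x) y ≡ p y
  p∖xy≡ rewrite ==-≢ (x≢y ∘ sym) = ∧-identityʳ (p y)
  rest : ∀ z → (p ∖ x ∖ y) z ≡ false
  rest z = ¬-not λ h → let p∖xz , z≢y = ∖-true⁻ (p ∖ x) h
                           pz , z≢x = ∖-true⁻ p p∖xz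
                       in [ z≢x , z≢y ] (cover z pz)

count-partition : (p q : Fin n → Bool) →
  count p ≡ count (λ x → p x ∧ q x) + count (λ x → p x ∧ not (q x))
count-partition {zero}  p q = refl
count-partition {suc n} p q = trans
  (cong₂ _+_ (indicator-split (p zero) (q zero)) (count-partition (p ∘ suc) (q ∘ suc)))
  (interchange (indicator (p zero ∧ q zero)) (indicator (p zero ∧ not (q zero))) _ _)
  where
  indicator-split : ∀ a b → indicator a ≡ indicator (a ∧ b) + indicator (a ∧ not b)
  indicator-split true  true  = refl
  indicator-split true  false = refl
  indicator-split false _     = refl

-- Outerplanar graphs are 2-degenerate

degreeIn : Graph n → (Fin n → Bool) → Fin n → ℕ
degreeIn G S v = count (λ u → adj G v u ∧ S u)

Degenerate : ℕ → Graph n → Set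
Degenerate {n} k G = ∀ (S : Fin n → Bool) s → S s ≡ true → ∃ λ v → S v ≡ true × degreeIn G S v ≤ k

module _ {G : Graph n} (outer : Outerplanar G) where

  private
    pos : Fin n → ℕ
    pos v = toℕ (proj₁ outer v)

    pos-injective : ∀ {u v} → pos u ≡ pos v → u ≡ v
    pos-injective = proj₁ (proj₂ outer) ∘ toℕ-injective

    uncrossed : ∀ a b c d → adj G a b ≡ true → adj G c d ≡ true →
      ¬ (pos a < pos c × pos c < pos b × pos b < pos d)
    uncrossed = proj₂ (proj₂ outer)

    ordered : ∀ {x y} → x ≢ y → pos x < pos y ⊎ pos y < pos x
    ordered {x} {y} x≢y with <-cmp (pos x) (pos y)
    ... | tri< lt _ _ = inj₁ lt
    ... | tri≈ _ eq _ = ⊥-elim (x≢y (pos-injective eq))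
    ... | tri> _ _ gt = inj₂ gt

    pigeonhole : ∀ {i j} → 2 < i + j → 1 < i ⊎ 1 < j
    pigeonhole {i} big with 1 <? i
    ... | yes 1<i = inj₁ 1<i
    ... | no  1≮i = inj₂ (s≤s⁻¹ (≤-trans big (+-monoˡ-≤ _ (≮⇒≥ 1≮i))))

    module Descent (S : Fin n → Bool) where

      N : Fin n → Fin n → Bool
      N w u = adj G w u ∧ S u

      LowVertex : Set
      LowVertex = ∃ λ v → S v ≡ true × degreeIn G S v ≤ 2

      data Fan (w : Fin n) : Set where
        rightwards : ∀ {x y} → N w x ≡ true → N w y ≡ true → pos w < pos x → pos x < pos y → Fan w
        leftwards  : ∀ {x y} → N w x ≡ true → N w y ≡ true → pos y < pos x → pos x < pos w → Fan w

      rightOf : Fin n → Fin n → Bool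
      rightOf w u = ⌊ pos w <? pos u ⌋

      leftOf⁻ : ∀ {w u} → N w u ≡ true → not (rightOf w u) ≡ true → pos u < pos w
      leftOf⁻ {w} {u} Nwu h with pos w <? pos u
      ... | no w≮u = ≤∧≢⇒< (≮⇒≥ w≮u) (λ eq → adj-≢ G (proj₁ (∧-true⁻ _ Nwu)) (sym (pos-injective eq)))

      fan : ∀ w → 2 < degreeIn G S w → Fan w
      fan w big with pigeonhole (subst (2 <_) (count-partition (N w) (rightOf w)) big)
      ... | inj₁ two-right =
        let x , y , x≢y , hx , hy = count-witness₂ _ two-right
            Nx , rx = ∧-true⁻ _ hx
            Ny , ry = ∧-true⁻ _ hy
        in case ordered x≢y of λ where
             (inj₁ x<y) → rightwards Nx Ny (⌊⌋-true⁻ rx) x<y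
             (inj₂ y<x) → rightwards Ny Nx (⌊⌋-true⁻ ry) y<x
      ... | inj₂ two-left =
        let x , y , x≢y , hx , hy = count-witness₂ _ two-left
            Nx , lx = ∧-true⁻ _ hx
            Ny , ly = ∧-true⁻ _ hy
        in case ordered x≢y of λ where
             (inj₁ x<y) → leftwards Ny Nx x<y (leftOf⁻ Ny ly)
             (inj₂ y<x) → leftwards Nx Ny y<x (leftOf⁻ Nx lx)

      Inside : Fin n → Fin n → Fin n → Set
      Inside a b w = adj G a b ≡ true × S w ≡ true × pos a < pos w × pos w < pos b

      -- A fan at w lies within the chord ab (no crossing), so its outer spoke is a strictly
      -- shorter chord with the inner spoke's endpoint inside.
      descend : ∀ d {a b w} → pos b ∸ pos a ≡ d → Inside a b w → LowVertex
      descend = <-rec _ λ d shorter {a} {b} {w} span≡d (ab , Sw , aw , wb) →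
        case degreeIn G S w ≤? 2 of λ where
          (yes small) → w , Sw , small
          (no big) → case fan w (≰⇒> big) of λ where
            (rightwards Nx Ny wx xy) →
              let wy = proj₁ (∧-true⁻ _ Ny)
                  y≤b = ≮⇒≥ (λ b<y → uncrossed a b w _ ab wy (aw , wb , b<y))
              in shorter (subst (_ <_) span≡d (≤-<-trans (∸-monoˡ-≤ (pos w) y≤b) (∸-monoʳ-< aw (<⇒≤ wb))))
                         refl (wy , proj₂ (∧-true⁻ _ Nx) , wx , xy)
            (leftwards Nx Ny yx xw) →
              let wy = proj₁ (∧-true⁻ _ Ny)
                  a≤y = ≮⇒≥ (λ y<a → uncrossed _ w a b (adj-sym G wy) ab (y<a , aw , wb))
              in shorter (subst (_ <_) span≡d (≤-<-trans (∸-monoʳ-≤ (pos w) a≤y) (∸-monoˡ-< wb (<⇒≤ aw))))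
                         refl (adj-sym G wy , proj₂ (∧-true⁻ _ Nx) , yx , xw)

      lowVertex : ∀ s → S s ≡ true → LowVertex
      lowVertex s Ss with degreeIn G S s ≤? 2
      ... | yes small = s , Ss , small
      ... | no big with fan s (≰⇒> big)
      ...   | rightwards Nx Ny sx xy = descend _ refl (proj₁ (∧-true⁻ _ Ny) , proj₂ (∧-true⁻ _ Nx) , sx , xy)
      ...   | leftwards Nx Ny yx xs  =
        descend _ refl (adj-sym G (proj₁ (∧-true⁻ _ Ny)) , proj₂ (∧-true⁻ _ Nx) , yx , xs)

  outerplanar⇒2-degenerate : Degenerate 2 G
  outerplanar⇒2-degenerate = Descent.lowVertex

-- Degeneracy orderings

record DegeneracyOrder (k : ℕ) (G : Graph n) : Set where
  field
    rank           : Fin n → ℕ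
    rank-injective : ∀ {u v} → rank u ≡ rank v → u ≡ v
    few-earlier    : ∀ v → count (λ u → adj G v u ∧ ⌊ rank u <? rank v ⌋) ≤ k

module _ {k} {G : Graph n} (degenerate : Degenerate k G) where

  private
    record OrderOn (S : Fin n → Bool) (m : ℕ) : Set where
      field
        rank        : Fin n → ℕ
        rank<       : ∀ {v} → S v ≡ true → rank v < m
        injective   : ∀ {u v} → S u ≡ true → S v ≡ true → rank u ≡ rank v → u ≡ v
        few-earlier : ∀ {v} → S v ≡ true → count (λ u → adj G v u ∧ (S u ∧ ⌊ rank u <? rank v ⌋)) ≤ k

    placeLast : ∀ {S m r} → S r ≡ true → degreeIn G S r ≤ k → OrderOn (S ∖ r) m → OrderOn S (suc m)
    placeLast {S} {m} {r} Sr few ord = record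
      { rank = rank′ ; rank< = rank′< ; injective = injective′ ; few-earlier = few-earlier′ }
      where
      open OrderOn ord

      rank′ : Fin n → ℕ
      rank′ u with u ≟ r
      ... | yes _ = m
      ... | no  _ = rank u

      rank′< : ∀ {v} → S v ≡ true → rank′ v < suc m
      rank′< {v} Sv with v ≟ r
      ... | yes _   = ≤-refl
      ... | no  v≢r = m≤n⇒m≤1+n (rank< (∖-true S Sv v≢r))

      injective′ : ∀ {u v} → S u ≡ true → S v ≡ true → rank′ u ≡ rank′ v → u ≡ v
      injective′ {u} {v} Su Sv eq with u ≟ r | v ≟ r
      ... | yes u≡r | yes v≡r = trans u≡r (sym v≡r)
      ... | yes _   | no  v≢r = ⊥-elim (<-irrefl (sym eq) (rank< (∖-true S Sv v≢r)))
      ... | no  u≢r | yes _   = ⊥-elim (<-irrefl eq (rank< (∖-true S Su u≢r)))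
      ... | no  u≢r | no  v≢r = injective (∖-true S Su u≢r) (∖-true S Sv v≢r) eq

      few-earlier′ : ∀ {v} → S v ≡ true → count (λ u → adj G v u ∧ (S u ∧ ⌊ rank′ u <? rank′ v ⌋)) ≤ k
      few-earlier′ {v} Sv with v ≟ r
      ... | yes refl = ≤-trans (count-mono _ (λ u → adj G r u ∧ S u) λ u h →
                         let ru , rest = ∧-true⁻ (adj G r u) h in ∧-true ru (proj₁ (∧-true⁻ (S u) rest))) few
      ... | no  v≢r  = ≤-trans (count-mono _ _ earlier) (few-earlier (∖-true S Sv v≢r))
        where
        earlier : ∀ u → adj G v u ∧ (S u ∧ ⌊ rank′ u <? rank v ⌋) ≡ true →
                  adj G v u ∧ ((S ∖ r) u ∧ ⌊ rank u <? rank v ⌋) ≡ true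
        earlier u h with u ≟ r | ∧-true⁻ (adj G v u) h
        ... | yes refl | _ , rest  =
          ⊥-elim (<-asym (⌊⌋-true⁻ (proj₂ (∧-true⁻ (S r) rest))) (rank< (∖-true S Sv v≢r)))
        ... | no  _    | vu , rest =
          let Su , u<v = ∧-true⁻ (S u) rest in ∧-true vu (∧-true (∧-true Su refl) u<v)

    orderOn : ∀ m S → count S ≡ m → OrderOn S m
    orderOn zero S empty = record
      { rank = λ _ → 0 ; rank< = absurd ; injective = λ Su _ _ → absurd Su ; few-earlier = absurd }
      where
      absurd : ∀ {A : Set} {v} → S v ≡ true → A
      absurd Sv = ⊥-elim (<-irrefl (sym empty) (count-pos S Sv))
    orderOn (suc m) S size =
      let s , Ss = count-witness S (subst (0 <_) (sym size) (s≤s z≤n))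
          r , Sr , few = degenerate S s Ss
      in placeLast Sr few (orderOn m (S ∖ r) (suc-injective (trans (sym (count-remove S Sr)) size)))

  degeneracyOrder : DegeneracyOrder k G
  degeneracyOrder = record
    { rank = rank ; rank-injective = injective refl refl ; few-earlier = λ v → few-earlier refl }
    where open OrderOn (orderOn n (λ _ → true) (count-all n))

-- Degree profiles over three colours

Profile : Set
Profile = Fin 3 → ℕ

ε : Profile
ε _ = 0

infixl 6 _⊕_
_⊕_ : Profile → Fin 3 → Profile
(β ⊕ a) c = β c + indicator (a == c)

⊕-hit : ∀ β a {k} → β a ≡ k → (β ⊕ a) a ≡ suc k
⊕-hit β a refl rewrite ==-refl a = +-comm (β a) 1

⊕-miss : ∀ β {a c k} → a ≢ c → β c ≡ k → (β ⊕ a) c ≡ k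
⊕-miss β a≢c refl rewrite ==-≢ a≢c = +-identityʳ _

⊕-comm : ∀ β a b c → (β ⊕ a ⊕ b) c ≡ (β ⊕ b ⊕ a) c
⊕-comm β a b c = xy∙z≈xz∙y (β c) (indicator (a == c)) (indicator (b == c))

⊕⊕-≢-suc : ∀ β γ c → (β ⊕ γ ⊕ γ) c ≢ suc (β c)
⊕⊕-≢-suc β γ c = case γ ≟ c of λ where
  (yes refl) → ≡-≢-trans (⊕-hit (β ⊕ γ) γ (⊕-hit β γ refl)) (1+n≢n ∘ suc-injective)
  (no  γ≢c)  → ≡-≢-trans (⊕-miss (β ⊕ γ) γ≢c (⊕-miss β γ≢c refl)) (1+n≢n ∘ sym)

fresh : (c c′ : Fin 3) → ∃ λ d → d ≢ c × d ≢ c′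
fresh zero             zero             = suc zero , (λ ()) , (λ ())
fresh zero             (suc zero)       = suc (suc zero) , (λ ()) , (λ ())
fresh zero             (suc (suc zero)) = suc zero , (λ ()) , (λ ())
fresh (suc zero)       zero             = suc (suc zero) , (λ ()) , (λ ())
fresh (suc zero)       (suc zero)       = zero , (λ ()) , (λ ())
fresh (suc zero)       (suc (suc zero)) = zero , (λ ()) , (λ ())
fresh (suc (suc zero)) zero             = suc zero , (λ ()) , (λ ())
fresh (suc (suc zero)) (suc zero)       = zero , (λ ()) , (λ ())
fresh (suc (suc zero)) (suc (suc zero)) = zero , (λ ()) , (λ ())

pred-≢ : ∀ {k x} → suc k ≡ x → k ≢ x
pred-≢ sk≡x k≡x = 1+n≢n (trans sk≡x (sym k≡x))

2+n≢n : ∀ {k} → suc (suc k) ≢ k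
2+n≢n {k} = >⇒≢ (<-trans (n<1+n k) (n<1+n (suc k)))

-- ε ⊕ c₁ ⊕ c₂ ⊕ a is the profile of a vertex of colour a whose only edges have colours c₁ and c₂;
-- D₁ and D₂ are the c₁- and c₂-degrees of the other ends of these edges.
SinkColourable : Fin 3 → ℕ → Fin 3 → ℕ → Set
SinkColourable c₁ D₁ c₂ D₂ = ∃ λ a → (ε ⊕ c₁ ⊕ c₂ ⊕ a) c₁ ≢ D₁ × (ε ⊕ c₁ ⊕ c₂ ⊕ a) c₂ ≢ D₂

sinkColourable-≢ : ∀ {c₁ c₂ D₁ D₂} → c₁ ≢ c₂ → (D₁ ≡ 1 → D₂ ≢ 1) → SinkColourable c₁ D₁ c₂ D₂
sinkColourable-≢ {c₁} {c₂} {D₁} {D₂} c₁≢c₂ not-both = choose (D₁ ≟ℕ 1) (D₂ ≟ℕ 1)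
  where
  δ = ε ⊕ c₁ ⊕ c₂
  δc₁ : δ c₁ ≡ 1
  δc₁ = ⊕-miss (ε ⊕ c₁) (≢-sym c₁≢c₂) (⊕-hit ε c₁ refl)
  δc₂ : δ c₂ ≡ 1
  δc₂ = ⊕-hit (ε ⊕ c₁) c₂ (⊕-miss ε c₁≢c₂ refl)
  2≢ : ∀ {D} → D ≡ 1 → 2 ≢ D
  2≢ refl ()
  choose : Dec (D₁ ≡ 1) → Dec (D₂ ≡ 1) → SinkColourable c₁ D₁ c₂ D₂
  choose (yes D₁≡1) _ =
    c₁ , ≡-≢-trans (⊕-hit δ c₁ δc₁) (2≢ D₁≡1)
       , ≡-≢-trans (⊕-miss δ c₁≢c₂ δc₂) (≢-sym (not-both D₁≡1))
  choose (no D₁≢1) (yes D₂≡1) =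
    c₂ , ≡-≢-trans (⊕-miss δ (≢-sym c₁≢c₂) δc₁) (≢-sym D₁≢1)
       , ≡-≢-trans (⊕-hit δ c₂ δc₂) (2≢ D₂≡1)
  choose (no D₁≢1) (no D₂≢1) =
    let t , t≢c₁ , t≢c₂ = fresh c₁ c₂ in
    t , ≡-≢-trans (⊕-miss δ t≢c₁ δc₁) (≢-sym D₁≢1)
      , ≡-≢-trans (⊕-miss δ t≢c₂ δc₂) (≢-sym D₂≢1)

sinkColourable-≡ : ∀ {c D₁ D₂} → (D₁ ≡ 2 → D₂ ≢ 3) → (D₁ ≡ 3 → D₂ ≢ 2) → SinkColourable c D₁ c D₂
sinkColourable-≡ {c} {D₁} {D₂} not-2-3 not-3-2 = choose (D₁ ≟ℕ 2) (D₂ ≟ℕ 2)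
  where
  δ = ε ⊕ c ⊕ c
  δc : δ c ≡ 2
  δc = ⊕-hit (ε ⊕ c) c (⊕-hit ε c refl)
  3≢ : ∀ {D} → D ≡ 2 → 3 ≢ D
  3≢ refl ()
  choose : Dec (D₁ ≡ 2) → Dec (D₂ ≡ 2) → SinkColourable c D₁ c D₂
  choose (yes D₁≡2) _ =
    c , ≡-≢-trans (⊕-hit δ c δc) (3≢ D₁≡2)
      , ≡-≢-trans (⊕-hit δ c δc) (≢-sym (not-2-3 D₁≡2))
  choose (no _) (yes D₂≡2) =
    c , ≡-≢-trans (⊕-hit δ c δc) (λ 3≡D₁ → not-3-2 (sym 3≡D₁) D₂≡2)
      , ≡-≢-trans (⊕-hit δ c δc) (3≢ D₂≡2)
  choose (no D₁≢2) (no D₂≢2) =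
    let t , t≢c , _ = fresh c c in
    t , ≡-≢-trans (⊕-miss δ t≢c δc) (≢-sym D₁≢2)
      , ≡-≢-trans (⊕-miss δ t≢c δc) (≢-sym D₂≢2)

-- Meets (just (c₀ , D₀)) b d: colouring vw with b, where v ends with b-degree d, keeps the sink w
-- colourable when its other edge has colour c₀ and leads to a vertex of c₀-degree D₀.
Meets : Maybe (Fin 3 × ℕ) → Fin 3 → ℕ → Set
Meets nothing          _ _ = ⊤
Meets (just (c₀ , D₀)) b d = SinkColourable c₀ D₀ b d

meets? : ∀ m b d → Dec (Meets m b d)
meets? nothing          _ _ = yes tt
meets? (just (c₀ , D₀)) b d =
  any? λ a → ¬? ((ε ⊕ c₀ ⊕ b ⊕ a) c₀ ≟ℕ D₀) ×-dec ¬? ((ε ⊕ c₀ ⊕ b ⊕ a) b ≟ℕ d)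

safeColour : Maybe (Fin 3 × ℕ) → Fin 3
safeColour nothing = zero
safeColour (just (c₀ , D₀)) with D₀ ≟ℕ 1
... | yes _ = c₀
... | no  _ = proj₁ (fresh c₀ c₀)

meets-safeColour : ∀ m d → Meets m (safeColour m) d
meets-safeColour nothing          _ = tt
meets-safeColour (just (c₀ , D₀)) d with D₀ ≟ℕ 1
... | yes refl = sinkColourable-≡ (λ ()) (λ ())
... | no  D₀≢1 = sinkColourable-≢ (≢-sym (proj₁ (proj₂ (fresh c₀ c₀)))) (⊥-elim ∘ D₀≢1)

meets-large : ∀ m b d → 3 < d → Meets m b d
meets-large nothing          _ _ _   = tt
meets-large (just (c₀ , D₀)) b d 3<d = case c₀ ≟ b of λ where
  (yes c₀≡b) → subst (λ b → SinkColourable c₀ D₀ b d) c₀≡b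
                 (sinkColourable-≡ (λ _ → >⇒≢ 3<d) (λ _ → >⇒≢ (<-trans (n<1+n 2) 3<d)))
  (no  c₀≢b) → sinkColourable-≢ c₀≢b (λ _ → >⇒≢ (<-trans (s≤s (s≤s z≤n)) 3<d))

meets-double : ∀ m β c → ∃ λ γ → γ ≢ c × Meets m γ ((β ⊕ γ ⊕ γ) γ)
meets-double nothing          β c = let γ , γ≢c , _ = fresh c c in γ , γ≢c , tt
meets-double (just (c₀ , D₀)) β c =
  let γ , γ≢c , γ≢c₀ = fresh c c₀ in
  γ , γ≢c , sinkColourable-≢ (≢-sym γ≢c₀) (λ _ → ≡-≢-trans (⊕-hit (β ⊕ γ) γ (⊕-hit β γ refl)) (λ ()))

meets-pair : ∀ m β {p q} → p ≢ q → 0 < β p →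
  ∃₂ λ a b → (∀ c → (β ⊕ b ⊕ a) c ≡ (β ⊕ p ⊕ q) c) × Meets m b ((β ⊕ b ⊕ a) b)
meets-pair nothing          β {p} {q} _ _ = q , p , (λ _ → refl) , tt
meets-pair (just (c₀ , D₀)) β {p} {q} p≢q 0<βp with p ≟ c₀ | D₀ ≟ℕ 1
... | no  p≢c₀ | _         = q , p , (λ _ → refl) , sinkColourable-≢ (≢-sym p≢c₀) (λ _ → d≢1)
  where
  d≢1 : (β ⊕ p ⊕ q) p ≢ 1
  d≢1 = ≡-≢-trans (⊕-miss (β ⊕ p) (≢-sym p≢q) (⊕-hit β p refl)) (>⇒≢ 0<βp ∘ suc-injective)
... | yes refl | yes refl  = q , p , (λ _ → refl) , sinkColourable-≡ (λ ()) (λ ())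
... | yes refl | no  D₀≢1 = p , q , ⊕-comm β q p , sinkColourable-≢ p≢q (⊥-elim ∘ D₀≢1)

-- β is the profile of the other edges at a vertex, a is its colour and b the colour of one
-- further edge; the constraint (cᵢ , xᵢ) forbids cᵢ-degree xᵢ, and the sink demand m must be met.
Choice : Maybe (Fin 3 × ℕ) → Profile → Fin 3 → ℕ → Fin 3 → ℕ → Set
Choice m β c₁ x₁ c₂ x₂ =
  ∃₂ λ a b → (β ⊕ b ⊕ a) c₁ ≢ x₁ × (β ⊕ b ⊕ a) c₂ ≢ x₂ × Meets m b ((β ⊕ b ⊕ a) b)

module _ (m : Maybe (Fin 3 × ℕ)) (β : Profile) {c₁ : Fin 3} {x₁ : ℕ} {c₂ : Fin 3} {x₂ : ℕ} where

  choice-pair : ∀ {p q} → p ≢ q → 0 < β p →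
    (β ⊕ p ⊕ q) c₁ ≢ x₁ → (β ⊕ p ⊕ q) c₂ ≢ x₂ → Choice m β c₁ x₁ c₂ x₂
  choice-pair p≢q 0<βp h₁ h₂ =
    let a , b , same , meets = meets-pair m β p≢q 0<βp in
    a , b , ≡-≢-trans (same c₁) h₁ , ≡-≢-trans (same c₂) h₂ , meets

  choice-double : ∀ c → (∀ γ → γ ≢ c → (β ⊕ γ ⊕ γ) c₁ ≢ x₁ × (β ⊕ γ ⊕ γ) c₂ ≢ x₂) →
    Choice m β c₁ x₁ c₂ x₂
  choice-double c avoids =
    let γ , γ≢c , meets = meets-double m β c
        h₁ , h₂ = avoids γ γ≢c
    in γ , γ , h₁ , h₂ , meets

choice-top : ∀ m β {c x₁ x₂} → 1 < β c →
  suc (suc (β c)) ≢ x₁ → suc (suc (β c)) ≢ x₂ → Choice m β c x₁ c x₂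
choice-top m β {c} 1<βc h₁ h₂ =
  c , c , ≡-≢-trans top h₁ , ≡-≢-trans top h₂ ,
  meets-large m c _ (subst (3 <_) (sym top) (s≤s (s≤s 1<βc)))
  where
  top : (β ⊕ c ⊕ c) c ≡ suc (suc (β c))
  top = ⊕-hit (β ⊕ c) c (⊕-hit β c refl)

avoid-one : ∀ β c x → ∃ λ a → (β ⊕ a) c ≢ x
avoid-one β c x = case β c ≟ℕ x of λ where
  (yes βc≡x) → c , ≡-≢-trans (⊕-hit β c refl) (λ eq → 1+n≢n (trans eq (sym βc≡x)))
  (no  βc≢x) → let t , t≢c , _ = fresh c c in t , ≡-≢-trans (⊕-miss β t≢c refl) βc≢x

-- cᵢ is bumped once exactly when β cᵢ + 1 ≢ xᵢ; if neither may be bumped, a doubled colour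
-- shifts each cᵢ-degree by 0 or 2.
avoid-two-≢ : ∀ m β {c₁ x₁ c₂ x₂} → c₁ ≢ c₂ → 0 < β c₁ → 0 < β c₂ → Choice m β c₁ x₁ c₂ x₂
avoid-two-≢ m β {c₁} {x₁} {c₂} {x₂} c₁≢c₂ 0<β₁ 0<β₂ with suc (β c₁) ≟ℕ x₁ | suc (β c₂) ≟ℕ x₂
... | no n₁  | no n₂  = choice-pair m β c₁≢c₂ 0<β₁
  (≡-≢-trans (⊕-miss (β ⊕ c₁) (≢-sym c₁≢c₂) (⊕-hit β c₁ refl)) n₁)
  (≡-≢-trans (⊕-hit (β ⊕ c₁) c₂ (⊕-miss β c₁≢c₂ refl)) n₂)
... | yes e₁ | no n₂  = let t , t≢c₁ , t≢c₂ = fresh c₁ c₂ in choice-pair m β (≢-sym t≢c₂) 0<β₂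
  (≡-≢-trans (⊕-miss (β ⊕ c₂) t≢c₁ (⊕-miss β (≢-sym c₁≢c₂) refl)) (pred-≢ e₁))
  (≡-≢-trans (⊕-miss (β ⊕ c₂) t≢c₂ (⊕-hit β c₂ refl)) n₂)
... | no n₁  | yes e₂ = let t , t≢c₁ , t≢c₂ = fresh c₁ c₂ in choice-pair m β (≢-sym t≢c₁) 0<β₁
  (≡-≢-trans (⊕-miss (β ⊕ c₁) t≢c₁ (⊕-hit β c₁ refl)) n₁)
  (≡-≢-trans (⊕-miss (β ⊕ c₁) t≢c₂ (⊕-miss β c₁≢c₂ refl)) (pred-≢ e₂))
... | yes e₁ | yes e₂ = choice-double m β c₁ λ γ _ →
  subst (_ ≢_) e₁ (⊕⊕-≢-suc β γ c₁) , subst (_ ≢_) e₂ (⊕⊕-≢-suc β γ c₂)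

-- One of β c, β c + 1, β c + 2 avoids x₁ and x₂; the last one is needed only when x₁ ≢ x₂,
-- and then the c-degree is at least 4, which meets every sink demand.
avoid-two-≡ : ∀ m β {c x₁ x₂} → 0 < β c → (x₁ ≢ x₂ → 1 < β c) → Choice m β c x₁ c x₂
avoid-two-≡ m β {c} {x₁} {x₂} 0<βc distinct
  with suc (β c) ≟ℕ x₁ | suc (β c) ≟ℕ x₂ | β c ≟ℕ x₁ | β c ≟ℕ x₂
... | no n₁  | no n₂  | _      | _      =
  let t , t≢c , _ = fresh c c in choice-pair m β (≢-sym t≢c) 0<βc
  (≡-≢-trans (⊕-miss (β ⊕ c) t≢c (⊕-hit β c refl)) n₁)
  (≡-≢-trans (⊕-miss (β ⊕ c) t≢c (⊕-hit β c refl)) n₂)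
... | _      | _      | no m₁  | no m₂  = choice-double m β c λ γ γ≢c →
  ≡-≢-trans (⊕-miss (β ⊕ γ) γ≢c (⊕-miss β γ≢c refl)) m₁ ,
  ≡-≢-trans (⊕-miss (β ⊕ γ) γ≢c (⊕-miss β γ≢c refl)) m₂
... | yes e₁ | _      | _      | yes f₂ = choice-top m β
  (distinct λ x₁≡x₂ → pred-≢ e₁ (trans f₂ (sym x₁≡x₂)))
  (λ eq → 1+n≢n (trans eq (sym e₁))) (λ eq → 2+n≢n (trans eq (sym f₂)))
... | _      | yes e₂ | yes f₁ | _      = choice-top m β
  (distinct λ x₁≡x₂ → pred-≢ e₂ (trans f₁ x₁≡x₂))
  (λ eq → 2+n≢n (trans eq (sym f₁))) (λ eq → 1+n≢n (trans eq (sym e₂)))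
... | yes e₁ | _      | yes f₁ | _      = ⊥-elim (pred-≢ e₁ f₁)
... | _      | yes e₂ | _      | yes f₂ = ⊥-elim (pred-≢ e₂ f₂)

avoid-two : ∀ m β {c₁ x₁ c₂ x₂} → 0 < β c₁ → 0 < β c₂ → (c₁ ≡ c₂ → x₁ ≢ x₂ → 1 < β c₁) →
  Choice m β c₁ x₁ c₂ x₂
avoid-two m β {c₁} {c₂ = c₂} 0<β₁ 0<β₂ same with c₁ ≟ c₂
... | no  c₁≢c₂ = avoid-two-≢ m β c₁≢c₂ 0<β₁ 0<β₂
... | yes refl  = avoid-two-≡ m β 0<β₁ (same refl)

-- The greedy colouring along a degeneracy order

module _ {P : Fin 3 → Fin 3 → Set} where

  pick : Dec (∃₂ P) → Fin 3 × Fin 3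
  pick (yes (a , b , _)) = a , b
  pick (no _)            = zero , zero

  pick-sound : (d : Dec (∃₂ P)) → ∃₂ P → P (proj₁ (pick d)) (proj₂ (pick d))
  pick-sound (yes (_ , _ , p)) _  = p
  pick-sound (no none)         ex = ⊥-elim (none ex)

module Greedy {n} {G : Graph n} (order : DegeneracyOrder 2 G) where

  open DegeneracyOrder order

  earlier : Fin n → Fin n → Bool
  earlier u v = ⌊ rank u <? rank v ⌋

  back forward : Fin n → Fin n → Bool
  back    v u = adj G v u ∧ earlier u v
  forward v w = adj G v w ∧ earlier v w

  adj⇒ordered : ∀ {u v} → adj G u v ≡ true → rank u < rank v ⊎ rank v < rank u
  adj⇒ordered {u} {v} uv with <-cmp (rank u) (rank v)
  ... | tri< lt _ _ = inj₁ lt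
  ... | tri≈ _ eq _ = ⊥-elim (adj-≢ G uv (rank-injective eq))
  ... | tri> _ _ gt = inj₂ gt

  back⁻ : ∀ {v u} → back v u ≡ true → adj G v u ≡ true × rank u < rank v
  back⁻ {v} {u} vu = let vu′ , u<v = ∧-true⁻ (adj G v u) vu in vu′ , ⌊⌋-true⁻ u<v

  forward⁻ : ∀ {v w} → forward v w ≡ true → adj G v w ≡ true × rank v < rank w
  forward⁻ {v} {w} vw = let vw′ , v<w = ∧-true⁻ (adj G v w) vw in vw′ , ⌊⌋-true⁻ v<w

  adj⇒back : ∀ {v z} → (∀ w → forward v w ≡ false) → adj G v z ≡ true → back v z ≡ true
  adj⇒back {v} {z} sink vz with adj⇒ordered vz
  ... | inj₁ v<z = case trans (sym (sink z)) (∧-true vz (⌊⌋-true (rank v <? rank z) v<z)) of λ ()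
  ... | inj₂ z<v = ∧-true vz (⌊⌋-true (rank z <? rank v) z<v)

  -- A row holds the colour of a vertex and the colours it gives to the edges towards its later
  -- neighbours; an edge takes its colour from the row of its earlier end.
  Row : Set
  Row = Fin 3 × (Fin n → Fin 3)

  Rows : Set
  Rows = Fin n → Row

  edgeColour : Rows → Fin n → Fin n → Fin 3
  edgeColour σ u w = if earlier u w then proj₂ (σ u) w else proj₂ (σ w) u

  deg : Rows → Fin 3 → Fin n → ℕ
  deg σ c v = count (λ w → adj G v w ∧ (edgeColour σ v w == c)) + indicator (proj₁ (σ v) == c)

  Irregular : Rows → Fin n → Fin n → Set
  Irregular σ u v = deg σ (edgeColour σ u v) u ≢ deg σ (edgeColour σ u v) v

  edgeColour-earlier : ∀ σ {u w} → rank u < rank w → edgeColour σ u w ≡ proj₂ (σ u) w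
  edgeColour-earlier σ {u} {w} u<w rewrite ⌊⌋-true (rank u <? rank w) u<w = refl

  edgeColour-later : ∀ σ {u w} → ¬ rank u < rank w → edgeColour σ u w ≡ proj₂ (σ w) u
  edgeColour-later σ {u} {w} u≮w rewrite ⌊⌋-false (rank u <? rank w) u≮w = refl

  edgeColour-sym : ∀ σ {u w} → adj G u w ≡ true → edgeColour σ u w ≡ edgeColour σ w u
  edgeColour-sym σ uw with adj⇒ordered uw
  ... | inj₁ u<w = trans (edgeColour-earlier σ u<w) (sym (edgeColour-later σ (<-asym u<w)))
  ... | inj₂ w<u = trans (edgeColour-later σ (<-asym w<u)) (sym (edgeColour-earlier σ w<u))

  Agree : ℕ → Rows → Rows → Set
  Agree r σ τ = ∀ w → rank w ≤ r → σ w ≡ τ w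

  agree-≤ : ∀ {r r′ σ τ} → r ≤ r′ → Agree r′ σ τ → Agree r σ τ
  agree-≤ r≤r′ σ≈τ w w≤r = σ≈τ w (≤-trans w≤r r≤r′)

  edgeColour-cong : ∀ {σ τ v} w → Agree (rank v) σ τ → edgeColour σ v w ≡ edgeColour τ v w
  edgeColour-cong {σ} {τ} {v} w σ≈τ with rank v <? rank w
  ... | yes _   = cong (λ r → proj₂ r w) (σ≈τ v ≤-refl)
  ... | no  v≮w = cong (λ r → proj₂ r v) (σ≈τ w (≮⇒≥ v≮w))

  deg-cong : ∀ {σ τ} c v → Agree (rank v) σ τ → deg σ c v ≡ deg τ c v
  deg-cong c v σ≈τ = cong₂ _+_
    (count-cong λ w → cong (λ c′ → adj G v w ∧ (c′ == c)) (edgeColour-cong w σ≈τ))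
    (cong (λ r → indicator (proj₁ r == c)) (σ≈τ v ≤-refl))

  irregular-cong : ∀ {σ τ u v} → rank u < rank v → Agree (rank v) σ τ → Irregular σ u v → Irregular τ u v
  irregular-cong {σ} {τ} {u} {v} u<v σ≈τ =
    subst (λ c → deg τ c u ≢ deg τ c v) (edgeColour-cong v σ≈τᵤ) ∘
    subst₂ _≢_ (deg-cong _ u σ≈τᵤ) (deg-cong _ v σ≈τ)
    where σ≈τᵤ = agree-≤ (<⇒≤ u<v) σ≈τ

  -- w has no later neighbours and its earlier neighbours are exactly v and o, where o precedes v;
  -- so vw is the last edge at w to be coloured, and only w's own colour is left to choose.
  SinkPartner : Fin n → Fin n → Fin n → Set
  SinkPartner v w o = (∀ z → forward w z ≡ false) × back w o ≡ true × rank o < rank v ×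
                      (∀ z → back w z ≡ true → z ≡ v ⊎ z ≡ o)

  sinkPartner? : ∀ v w o → Dec (SinkPartner v w o)
  sinkPartner? v w o =
    all? (λ z → forward w z Bool.≟ false) ×-dec (back w o Bool.≟ true) ×-dec (rank o <? rank v) ×-dec
    all? (λ z → (back w z Bool.≟ true) →-dec (z ≟ v ⊎-dec z ≟ o))

  sinkDemand : Rows → Fin n → Fin n → Maybe (Fin 3 × ℕ)
  sinkDemand σ v w with any? (sinkPartner? v w)
  ... | yes (o , _) = just (edgeColour σ o w , deg σ (edgeColour σ o w) o)
  ... | no  _       = nothing

  sinkDemand-partner : ∀ σ {v w o} → SinkPartner v w o →
    sinkDemand σ v w ≡ just (edgeColour σ o w , deg σ (edgeColour σ o w) o)
  sinkDemand-partner σ {v} {w} {o} partner with any? (sinkPartner? v w)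
  ... | no none = ⊥-elim (none (o , partner))
  ... | yes (o′ , _ , wo′ , o′<v , _) with proj₂ (proj₂ (proj₂ partner)) o′ wo′
  ...   | inj₁ refl = ⊥-elim (<-irrefl refl o′<v)
  ...   | inj₂ refl = refl

  firstForward : Fin n → Maybe (Fin n)
  firstForward v with any? (λ w → forward v w Bool.≟ true)
  ... | yes (e , _) = just e
  ... | no  _       = nothing

  firstForward-just : ∀ {v e} → firstForward v ≡ just e → forward v e ≡ true
  firstForward-just {v} eq with any? (λ w → forward v w Bool.≟ true)
  firstForward-just refl | yes (_ , ve) = ve

  firstForward-nothing : ∀ {v} → firstForward v ≡ nothing → ∀ w → forward v w ≡ false
  firstForward-nothing {v} eq w with any? (λ w → forward v w Bool.≟ true)
  ... | no none = Bool.¬-not (none ∘ (w ,_))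

  isFirstForward : Fin n → Fin n → Bool
  isFirstForward v w = ⌊ Maybe.≡-dec _≟_ (firstForward v) (just w) ⌋

  isFirstForward-just : ∀ {v e} → firstForward v ≡ just e → isFirstForward v e ≡ true
  isFirstForward-just {v} {e} first = ⌊⌋-true (Maybe.≡-dec _≟_ (firstForward v) (just e)) first

  isFirstForward-other : ∀ {v e w} → firstForward v ≡ just e → w ≢ e → isFirstForward v w ≡ false
  isFirstForward-other {v} {e} {w} first w≢e =
    ⌊⌋-false (Maybe.≡-dec _≟_ (firstForward v) (just w)) λ eq → w≢e (just-injective (trans (sym eq) first))

  isFirstForward-nothing : ∀ {v w} → firstForward v ≡ nothing → isFirstForward v w ≡ false
  isFirstForward-nothing {v} {w} none =
    ⌊⌋-false (Maybe.≡-dec _≟_ (firstForward v) (just w)) (λ eq → case trans (sym none) eq of λ ())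

  row : Rows → Fin n → Fin 3 × Fin 3 → Row
  row σ v (a , b) = a , λ w → if isFirstForward v w then b else safeColour (sinkDemand σ v w)

  assign : Rows → Fin n → Fin 3 × Fin 3 → Rows
  assign σ v ab u = if u == v then row σ v ab else σ u

  assign-self : ∀ σ v ab → assign σ v ab v ≡ row σ v ab
  assign-self σ v ab rewrite ==-refl v = refl

  assign-other : ∀ σ {v u} ab → u ≢ v → assign σ v ab u ≡ σ u
  assign-other σ ab u≢v rewrite ==-≢ u≢v = refl

  assign-agree : ∀ σ {v r} ab → r < rank v → Agree r (assign σ v ab) σ
  assign-agree σ ab r<v w w≤r = assign-other σ ab λ { refl → <-irrefl refl (≤-<-trans w≤r r<v) }

  firstDemand : Rows → Fin n → Maybe (Fin 3 × ℕ)
  firstDemand σ v = firstForward v >>= sinkDemand σ v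

  Good : Rows → Fin n → Fin 3 × Fin 3 → Set
  Good σ v (a , b) =
    (∀ u → back v u ≡ true → Irregular (assign σ v (a , b)) u v) ×
    Meets (firstDemand σ v) b (deg (assign σ v (a , b)) b v)

  good? : ∀ σ v ab → Dec (Good σ v ab)
  good? σ v (a , b) =
    all? (λ u → (back v u Bool.≟ true) →-dec
                ¬? (deg σ′ (edgeColour σ′ u v) u ≟ℕ deg σ′ (edgeColour σ′ u v) v))
    ×-dec meets? (firstDemand σ v) b (deg σ′ b v)
    where σ′ = assign σ v (a , b)

  opaque
    decide : Rows → Fin n → Fin 3 × Fin 3
    decide σ v = pick (any? λ a → any? λ b → good? σ v (a , b))

    decide-good : ∀ σ v → ∃₂ (λ a b → Good σ v (a , b)) → Good σ v (decide σ v)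
    decide-good σ v = pick-sound (any? λ a → any? λ b → good? σ v (a , b))

  state : ℕ → Rows
  state zero    _ = zero , λ _ → zero
  state (suc k) u with rank u ≟ℕ k
  ... | yes _ = row (state k) u (decide (state k) u)
  ... | no  _ = state k u

  settled : Rows
  settled u = row (state (rank u)) u (decide (state (rank u)) u)

  GoodAt : Fin n → Set
  GoodAt v = Good (state (rank v)) v (decide (state (rank v)) v)

  state-settled : ∀ k {u} → rank u < k → state k u ≡ settled u
  state-settled (suc k) {u} u<k with rank u ≟ℕ k
  ... | yes refl = refl
  ... | no  u≢k  = state-settled k (≤∧≢⇒< (s≤s⁻¹ u<k) u≢k)

  state≈settled : ∀ {r k} → r < k → Agree r (state k) settled
  state≈settled r<k w w≤r = state-settled _ (≤-<-trans w≤r r<k)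

  assigned≈settled : ∀ v → Agree (rank v) (assign (state (rank v)) v (decide (state (rank v)) v)) settled
  assigned≈settled v w w≤v with w ≟ v
  ... | yes refl = refl
  ... | no  w≢v  = state-settled (rank v) (≤∧≢⇒< w≤v (w≢v ∘ rank-injective))

  settled-irregular : ∀ {u v} → GoodAt v → back v u ≡ true → Irregular settled u v
  settled-irregular {u} {v} good vu = irregular-cong (proj₂ (back⁻ vu)) (assigned≈settled v) (proj₁ good u vu)

  colouring : TotalColoring G 3
  colouring = record
    { vcol = proj₁ ∘ settled ; ecol = edgeColour settled ; ecol-sym = λ _ _ → edgeColour-sym settled }

  totalDeg≡deg : ∀ c v → totalDeg colouring c v ≡ deg settled c v
  totalDeg≡deg c v = cong (_+ indicator (proj₁ (settled v) == c))
    (length-filterᵇ-allFin (λ w → adj G v w ∧ (edgeColour settled v w == c)))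

  colouring-tlir : (∀ v → GoodAt v) → IsTLIR colouring
  colouring-tlir good u v uv with adj⇒ordered uv
  ... | inj₁ u<v = subst₂ _≢_ (sym (totalDeg≡deg _ u)) (sym (totalDeg≡deg _ v))
                     (settled-irregular (good v) (∧-true (adj-sym G uv) (⌊⌋-true (rank u <? rank v) u<v)))
  ... | inj₂ v<u = subst (λ c → totalDeg colouring c u ≢ totalDeg colouring c v)
                     (edgeColour-sym settled (adj-sym G uv))
                     (subst₂ _≢_ (sym (totalDeg≡deg _ u)) (sym (totalDeg≡deg _ v))
                       (≢-sym (settled-irregular (good u) (∧-true uv (⌊⌋-true (rank v <? rank u) v<u)))))

  -- The colour of the edge vw once v is settled, unless vw is v's first edge to a later neighbour.
  otherColour : Rows → Fin n → Fin n → Fin 3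
  otherColour σ v w = if earlier v w then safeColour (sinkDemand σ v w) else proj₂ (σ w) v

  otherEdges : Rows → Fin n → Fin 3 → Fin n → Bool
  otherEdges σ v c w = adj G v w ∧ (otherColour σ v w == c)

  otherEdges-back : ∀ σ {v u} c → back v u ≡ true → otherEdges σ v c u ≡ (proj₂ (σ u) v == c)
  otherEdges-back σ {v} {u} c vu
    rewrite proj₁ (back⁻ vu) | ⌊⌋-false (rank v <? rank u) (<-asym (proj₂ (back⁻ vu))) = refl

  profile : Rows → Fin n → Profile
  profile σ v c = count (otherEdges σ v c)

  profileExcept : Rows → Fin n → Fin n → Profile
  profileExcept σ v e c = count (otherEdges σ v c ∖ e)

  edgeColour-assign : ∀ σ v ab {w} → adj G v w ≡ true → isFirstForward v w ≡ false →
    edgeColour (assign σ v ab) v w ≡ otherColour σ v w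
  edgeColour-assign σ v ab {w} vw notFirst with rank v <? rank w
  ... | yes _ rewrite assign-self σ v ab | notFirst = refl
  ... | no  _ rewrite assign-other σ ab (adj-≢ G vw ∘ sym) = refl

  deg-assign-forward : ∀ σ {v e} a b c → firstForward v ≡ just e →
    deg (assign σ v (a , b)) c v ≡ (profileExcept σ v e ⊕ b ⊕ a) c
  deg-assign-forward σ {v} {e} a b c first = begin
    deg σ′ c v
      ≡⟨ cong₂ _+_ (count-split P e) (cong (λ r → indicator (proj₁ r == c)) (assign-self σ v (a , b))) ⟩
    indicator (P e) + count (P ∖ e) + indicator (a == c)
      ≡⟨ cong (_+ indicator (a == c)) (cong₂ _+_ (cong indicator Pe≡) (count-cong (∖-cong P _ e others))) ⟩
    indicator (b == c) + profileExcept σ v e c + indicator (a == c)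
      ≡⟨ cong (_+ indicator (a == c)) (+-comm (indicator (b == c)) _) ⟩
    (profileExcept σ v e ⊕ b ⊕ a) c ∎
    where
    open ≡-Reasoning
    σ′ = assign σ v (a , b)
    P = λ w → adj G v w ∧ (edgeColour σ′ v w == c)
    ve = ∧-true⁻ (adj G v e) (firstForward-just first)
    Pe≡ : P e ≡ (b == c)
    Pe≡ rewrite proj₁ ve | edgeColour-earlier σ′ (⌊⌋-true⁻ (proj₂ ve)) | assign-self σ v (a , b)
              | isFirstForward-just first = refl
    others : ∀ w → w ≢ e → P w ≡ otherEdges σ v c w
    others w w≢e = ∧-cong λ vw → cong (_== c) (edgeColour-assign σ v (a , b) vw (isFirstForward-other first w≢e))

  deg-assign-sink : ∀ σ {v} a b c → firstForward v ≡ nothing →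
    deg (assign σ v (a , b)) c v ≡ (profile σ v ⊕ a) c
  deg-assign-sink σ {v} a b c none = cong₂ _+_
    (count-cong λ w → ∧-cong λ vw →
      cong (_== c) (edgeColour-assign σ v (a , b) vw (isFirstForward-nothing {w = w} none)))
    (cong (λ r → indicator (proj₁ r == c)) (assign-self σ v (a , b)))

  good-intro : ∀ σ v a b →
    (∀ u → back v u ≡ true → deg (assign σ v (a , b)) (proj₂ (σ u) v) v ≢ deg σ (proj₂ (σ u) v) u) →
    Meets (firstDemand σ v) b (deg (assign σ v (a , b)) b v) → Good σ v (a , b)
  good-intro σ v a b avoids meets = irregular , meets
    where
    σ′ = assign σ v (a , b)
    irregular : ∀ u → back v u ≡ true → Irregular σ′ u v
    irregular u vu = subst (λ c → deg σ′ c u ≢ deg σ′ c v) (sym colour≡)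
      (≢-sym (subst (deg σ′ c v ≢_) (sym (deg-cong c u (assign-agree σ (a , b) u<v))) (avoids u vu)))
      where
      u<v = proj₂ (back⁻ vu)
      c = proj₂ (σ u) v
      colour≡ : edgeColour σ′ u v ≡ c
      colour≡ = trans (edgeColour-earlier σ′ u<v)
        (cong (λ r → proj₂ r v) (assign-other σ (a , b) λ { refl → <-irrefl refl u<v }))

  good-forward : ∀ σ {v e} → firstForward v ≡ just e → ∃₂ λ a b → Good σ v (a , b)
  good-forward σ {v} {e} first = byBack (count≤2⇒atMostTwo (back v) (few-earlier v))
    where
    β = profileExcept σ v e
    m = sinkDemand σ v e
    colour : Fin n → Fin 3
    colour u = proj₂ (σ u) v
    member : ∀ {u} → back v u ≡ true → (otherEdges σ v (colour u) ∖ e) u ≡ true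
    member {u} vu =
      ∖-true (otherEdges σ v (colour u)) (trans (otherEdges-back σ (colour u) vu) (==-refl (colour u)))
        λ { refl → <-asym (proj₂ (back⁻ vu)) (proj₂ (forward⁻ (firstForward-just first))) }
    β-pos : ∀ {u} → back v u ≡ true → 0 < β (colour u)
    β-pos {u} vu = count-pos (otherEdges σ v (colour u) ∖ e) (member vu)
    avoids-at : ∀ a b u → (β ⊕ b ⊕ a) (colour u) ≢ deg σ (colour u) u →
      deg (assign σ v (a , b)) (colour u) v ≢ deg σ (colour u) u
    avoids-at a b u = subst (_≢ deg σ (colour u) u) (sym (deg-assign-forward σ a b (colour u) first))
    meets-at : ∀ a b → Meets m b ((β ⊕ b ⊕ a) b) → Meets (firstDemand σ v) b (deg (assign σ v (a , b)) b v)
    meets-at a b = subst₂ (λ m d → Meets m b d)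
      (sym (cong (_>>= sinkDemand σ v) first)) (sym (deg-assign-forward σ a b b first))
    byBack : AtMostTwo (back v) → ∃₂ λ a b → Good σ v (a , b)
    byBack (inj₁ nobody) =
      let γ , _ , meets = meets-double m β zero in
      γ , γ , good-intro σ v γ γ (λ u vu → case trans (sym vu) (nobody u) of λ ()) (meets-at γ γ meets)
    byBack (inj₂ (x , y , vx , vy , cover)) =
      let a , b , avoids-x , avoids-y , meets = avoid-two m β (β-pos vx) (β-pos vy) β-two in
      a , b , good-intro σ v a b (λ u vu → case cover u vu of λ where
                                     (inj₁ refl) → avoids-at a b x avoids-x
                                     (inj₂ refl) → avoids-at a b y avoids-y)
                (meets-at a b meets)
      where
      β-two : colour x ≡ colour y → deg σ (colour x) x ≢ deg σ (colour y) y → 1 < β (colour x)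
      β-two same differ with x ≟ y
      ... | yes refl = ⊥-elim (differ refl)
      ... | no  x≢y  = count-pos₂ _ x≢y (member vx)
                         (subst (λ c → (otherEdges σ v c ∖ e) y ≡ true) (sym same) (member vy))

  row-meets : ∀ σ v ab w → Good σ v ab →
    Meets (sinkDemand σ v w) (proj₂ (row σ v ab) w) (deg (assign σ v ab) (proj₂ (row σ v ab) w) v)
  row-meets σ v ab w good with isFirstForward v w in first
  ... | true  = subst (λ m → Meets m (proj₂ ab) (deg (assign σ v ab) (proj₂ ab) v))
                      (cong (_>>= sinkDemand σ v) (⌊⌋-true⁻ first)) (proj₂ good)
  ... | false = meets-safeColour _ _

  settled-meets : ∀ {v w} → GoodAt v →
    Meets (sinkDemand (state (rank v)) v w) (proj₂ (settled v) w) (deg settled (proj₂ (settled v) w) v)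
  settled-meets {v} {w} good =
    subst (Meets _ _) (deg-cong _ v (assigned≈settled v)) (row-meets (state (rank v)) v _ w good)

  sink-colourable : ∀ {v t₁ t₂} → GoodAt t₂ → (∀ z → forward v z ≡ false) →
    back v t₁ ≡ true → back v t₂ ≡ true → rank t₁ < rank t₂ → (∀ z → back v z ≡ true → z ≡ t₂ ⊎ z ≡ t₁) →
    SinkColourable (edgeColour settled t₁ v) (deg settled (edgeColour settled t₁ v) t₁)
                   (edgeColour settled t₂ v) (deg settled (edgeColour settled t₂ v) t₂)
  sink-colourable {v} {t₁} {t₂} good sink vt₁ vt₂ t₁<t₂ cover =
    subst₂ (λ c D → SinkColourable c D c₂ (deg settled c₂ t₂)) colour₁≡ degree₁≡
      (subst (λ c → SinkColourable (edgeColour σ₂ t₁ v) (deg σ₂ (edgeColour σ₂ t₁ v) t₁) c (deg settled c t₂))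
             (sym (edgeColour-earlier settled (proj₂ (back⁻ vt₂))))
        (subst (λ m → Meets m (proj₂ (settled t₂) v) (deg settled (proj₂ (settled t₂) v) t₂))
               (sinkDemand-partner σ₂ (sink , vt₁ , t₁<t₂ , cover)) (settled-meets {t₂} {v} good)))
    where
    σ₂ = state (rank t₂)
    c₂ = edgeColour settled t₂ v
    colour₁≡ : edgeColour σ₂ t₁ v ≡ edgeColour settled t₁ v
    colour₁≡ = edgeColour-cong v (state≈settled t₁<t₂)
    degree₁≡ : deg σ₂ (edgeColour σ₂ t₁ v) t₁ ≡ deg settled (edgeColour settled t₁ v) t₁
    degree₁≡ = trans (deg-cong _ t₁ (state≈settled t₁<t₂)) (cong (λ c → deg settled c t₁) colour₁≡)

  meets-sink : ∀ σ {v} b d → firstForward v ≡ nothing → Meets (firstDemand σ v) b d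
  meets-sink σ {v} b d none = subst (λ m → Meets m b d) (sym (cong (_>>= sinkDemand σ v) none)) tt

  good-two-sink : ∀ {v t₁ t₂} → GoodAt t₂ → firstForward v ≡ nothing →
    back v t₁ ≡ true → back v t₂ ≡ true → t₁ ≢ t₂ → rank t₁ < rank t₂ → (∀ z → back v z ≡ true → z ≡ t₂ ⊎ z ≡ t₁) →
    ∃₂ λ a b → Good (state (rank v)) v (a , b)
  good-two-sink {v} {t₁} {t₂} good none vt₁ vt₂ t₁≢t₂ t₁<t₂ cover =
    let a , avoids₁ , avoids₂ = sink-colourable good sink vt₁ vt₂ t₁<t₂ cover in
    a , zero , good-intro σ v a zero (λ u vu → case cover u vu of λ where
                                        (inj₁ refl) → irregular a vt₂ avoids₂
                                        (inj₂ refl) → irregular a vt₁ avoids₁)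
                 (meets-sink σ zero _ none)
    where
    σ = state (rank v)
    sink = firstForward-nothing none
    c₁ = edgeColour settled t₁ v
    c₂ = edgeColour settled t₂ v
    colour≡ : ∀ {u} → back v u ≡ true → proj₂ (σ u) v ≡ edgeColour settled u v
    colour≡ vu = let u<v = proj₂ (back⁻ vu) in
      trans (cong (λ r → proj₂ r v) (state-settled _ u<v)) (sym (edgeColour-earlier settled u<v))
    profile≡ : ∀ c → profile σ v c ≡ (ε ⊕ c₁ ⊕ c₂) c
    profile≡ c = trans (count-⊆pair _ t₁≢t₂ support)
      (cong₂ _+_ (cong indicator (trans (otherEdges-back σ c vt₁) (cong (_== c) (colour≡ vt₁))))
                 (cong indicator (trans (otherEdges-back σ c vt₂) (cong (_== c) (colour≡ vt₂)))))
      where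
      support : ∀ z → otherEdges σ v c z ≡ true → z ≡ t₁ ⊎ z ≡ t₂
      support z vz with cover z (adj⇒back sink (proj₁ (∧-true⁻ (adj G v z) vz)))
      ... | inj₁ z≡t₂ = inj₂ z≡t₂
      ... | inj₂ z≡t₁ = inj₁ z≡t₁
    irregular : ∀ a {u} → back v u ≡ true →
      (ε ⊕ c₁ ⊕ c₂ ⊕ a) (edgeColour settled u v) ≢ deg settled (edgeColour settled u v) u →
      deg (assign σ v (a , zero)) (proj₂ (σ u) v) v ≢ deg σ (proj₂ (σ u) v) u
    irregular a {u} vu avoids = subst (λ c → deg (assign σ v (a , zero)) c v ≢ deg σ c u) (sym (colour≡ vu))
      (≡-≢-trans (trans (deg-assign-sink σ a zero c none) (cong (_+ indicator (a == c)) (profile≡ c)))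
                 (subst ((ε ⊕ c₁ ⊕ c₂ ⊕ a) c ≢_) (sym (deg-cong c u (state≈settled (proj₂ (back⁻ vu))))) avoids))
      where c = edgeColour settled u v

  good-sink : ∀ {v} → (∀ {u} → rank u < rank v → GoodAt u) → firstForward v ≡ nothing →
    ∃₂ λ a b → Good (state (rank v)) v (a , b)
  good-sink {v} earlier-good none = byBack (count≤2⇒atMostTwo (back v) (few-earlier v))
    where
    σ = state (rank v)
    colour : Fin n → Fin 3
    colour u = proj₂ (σ u) v
    byBack : AtMostTwo (back v) → ∃₂ λ a b → Good σ v (a , b)
    byBack (inj₁ nobody) = zero , zero ,
      good-intro σ v zero zero (λ u vu → case trans (sym vu) (nobody u) of λ ()) (meets-sink σ zero _ none)
    byBack (inj₂ (x , y , vx , vy , cover)) = case x ≟ y of λ where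
      (yes refl) →
        let a , avoids = avoid-one (profile σ v) (colour x) (deg σ (colour x) x)
            avoids′ = subst (_≢ deg σ (colour x) x) (sym (deg-assign-sink σ a zero (colour x) none)) avoids
        in a , zero , good-intro σ v a zero
                        (λ u vu → case cover u vu of λ { (inj₁ refl) → avoids′ ; (inj₂ refl) → avoids′ })
                        (meets-sink σ zero _ none)
      (no x≢y) → case <-cmp (rank x) (rank y) of λ where
        (tri< x<y _ _) → good-two-sink (earlier-good (proj₂ (back⁻ vy))) none vx vy x≢y x<y (λ u → swap ∘ cover u)
        (tri≈ _ x≡y _) → ⊥-elim (x≢y (rank-injective x≡y))
        (tri> _ _ y<x) → good-two-sink (earlier-good (proj₂ (back⁻ vx))) none vy vx (≢-sym x≢y) y<x cover

  good-exists : ∀ v → (∀ {u} → rank u < rank v → GoodAt u) → ∃₂ λ a b → Good (state (rank v)) v (a , b)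
  good-exists v earlier-good = byFirst (firstForward v) refl
    where
    byFirst : ∀ m → firstForward v ≡ m → ∃₂ λ a b → Good (state (rank v)) v (a , b)
    byFirst (just _) first = good-forward _ first
    byFirst nothing  none  = good-sink earlier-good none

  all-good : ∀ v → GoodAt v
  all-good = All.wfRec (On.wellFounded rank <-wellFounded) _ GoodAt λ v earlier-good →
    decide-good (state (rank v)) v (good-exists v earlier-good)

degenerate⇒tlir≤3 : {G : Graph n} → Degenerate 2 G → TlirAtMost G 3
degenerate⇒tlir≤3 degenerate = colouring , colouring-tlir all-good
  where open Greedy (degeneracyOrder degenerate)

theorem8 : ∀ (n : ℕ) (G : Graph n) → Outerplanar G → TlirAtMost G 3
theorem8 n G outer = degenerate⇒tlir≤3 (outerplanar⇒2-degenerate {G = G} outer)
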